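{- Let $(B_+,\mathcal C_+,B_-,\mathcal C_-;\mathsf{con}_1,\mathsf{tot}_1)$ be a presentation of a pre-d-frame satisfying: ($\mu_+$): $\alpha\in\mathsf{con}_\vee$, $\beta\in\mathsf{tot}_\wedge$, $\beta_+\le\alpha_+$ imply $\alpha_-\le\beta_-$; ($\mu_-$): $\alpha\in\mathsf{con}_\wedge$, $\beta\in\mathsf{tot}_\vee$, $\beta_-\le\alpha_-$ imply $\alpha_+\le\beta_+$; (Indep$_+$): $(L_+\times B_-)\cap\downarrow\mathsf{con}_{\wedge,\bigvee}\subseteq\downarrow\mathsf{con}_\vee$; (Indep$_-$): $(B_+\times L_-)\cap\downarrow\mathsf{con}_{\vee,\bigwedge}\subseteq\downarrow\mathsf{con}_\wedge$. Then the generated pre-d-frame $(L_+,L_-;\mathsf{Con}_*,\mathsf{Tot}_*)$ satisfies (con-tot): if $\alpha\in\mathsf{Con}_*$, $\beta\in\mathsf{Tot}_*$ and ($\alpha_+=\beta_+$ or $\alpha_-=\beta_-$) then $\alpha\sqsubseteq\beta$.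
   Context: A frame presentation $(B,\mathcal C)$: $B$ a meet-semilattice with top, $\mathcal C$ a set of pairs $U\dashv a$ ($a\in B$, $U\subseteq\downarrow a$) with $U\dashv a\in\mathcal C$, $b\le a\Rightarrow\{u\wedge b:u\in U\}\dashv b\in\mathcal C$. $\mathcal C$-ideals are downsets $I\subseteq B$ with $U\dashv a\in\mathcal C,U\subseteq I\Rightarrow a\in I$; they form a frame under inclusion. A presentation of a pre-d-frame is $(B_+,\mathcal C_+,B_-,\mathcal C_-;\mathsf{con}_1,\mathsf{tot}_1)$ with $(B_\pm,\mathcal C_\pm)$ frame presentations and $\mathsf{con}_1,\mathsf{tot}_1\subseteq B_+\times B_-$. $L_\pm$ is the frame of $\mathcal C_\pm$-ideals; $b\in B_\pm$ is identified with the smallest $\mathcal C_\pm$-ideal containing it, so $B_\pm\subseteq L_\pm$ and $\mathsf{con}_1,\mathsf{tot}_1\subseteq L_+\times L_-$. On $L_+\times L_-$: $\alpha\sqsubseteq\beta$ iff $\alpha_+\le\beta_+,\alpha_-\le\beta_-$; logical join $\alpha\vee\beta=(\alpha_+\vee\beta_+,\alpha_-\wedge\beta_-)$, meet $\alpha\wedge\beta=(\alpha_+\wedge\beta_+,\alpha_-\vee\beta_-)$; $tt=(1,0)$, $ff=(0,1)$. $\mathsf{Con}_*$: smallest relation containing $\mathsf{con}_1,tt,ff$, $\sqsubseteq$-downward closed, closed under logical $\wedge,\vee$ and coordinatewise joins of $\sqsubseteq$-directed sets; $\mathsf{Tot}_*$: smallest containing $\mathsf{tot}_1,tt,ff$,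 $\sqsubseteq$-upward closed, closed under logical $\wedge,\vee$. $\mathsf{con}_\wedge,\mathsf{con}_\vee$ (resp. $\mathsf{tot}_\wedge,\mathsf{tot}_\vee$) are the closures of $\mathsf{con}_1$ (resp. $\mathsf{tot}_1$) under finite logical meets, resp. finite logical joins. $\mathsf{con}_{\wedge,\bigvee}=\{(\bigvee_i\alpha^i_+,\bigwedge_i\alpha^i_-):\{\alpha^i\}_i\subseteq\mathsf{con}_\wedge\}$, $\mathsf{con}_{\vee,\bigwedge}=\{(\bigwedge_i\alpha^i_+,\bigvee_i\alpha^i_-):\{\alpha^i\}_i\subseteq\mathsf{con}_\vee\}$. $\downarrow R$ is the $\sqsubseteq$-downward closure. -}

module Defs where

open import Level using (0ℓ)
open import Data.Product using (Σ; ∃; _×_; _,_; proj₁; proj₂)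
open import Data.Sum using (_⊎_; inj₁; inj₂)
open import Data.Unit using (⊤; tt)
open import Data.Empty using (⊥)
open import Relation.Binary.PropositionalEquality using (_≡_)
open import Relation.Binary.Lattice.Structures using (IsBoundedMeetSemilattice)

-- The set C of covers U ⊣ a is given as an indexed family: each
-- c : Cov is one pair  U ⊣ a  with  a = apex c  and
-- U = { elt c i | i : Idx c }  (every subset is such an image, so this
-- loses no generality).

record FramePres : Set₁ where
  field
    Carrier : Set
    _≤_     : Carrier → Carrier → Set
    _∧_     : Carrier → Carrier → Carrier
    top     : Carrier
    isBMS   : IsBoundedMeetSemilattice _≡_ _≤_ _∧_ top
    Cov     : Set
    apex    : Cov → Carrier
    Idx     : Cov → Set
    elt     : (c : Cov) → Idx c → Carrier
    elt≤apex : ∀ c i → elt c i ≤ apex c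
    stable  : ∀ c b → b ≤ apex c →
              Σ Cov λ c' → (apex c' ≡ b)
                × (∀ j → ∃ λ i → elt c' j ≡ (elt c i ∧ b))
                × (∀ i → ∃ λ j → elt c' j ≡ (elt c i ∧ b))

module _ (F : FramePres) where
  open FramePres F

  record Ideal : Set₁ where
    field
      mem        : Carrier → Set
      downClosed : ∀ {x y} → y ≤ x → mem x → mem y
      covClosed  : ∀ c → (∀ i → mem (elt c i)) → mem (apex c)
  open Ideal public

  _⊆I_ : Ideal → Ideal → Set
  I ⊆I J = ∀ x → mem I x → mem J x

  _≈I_ : Ideal → Ideal → Set
  I ≈I J = (I ⊆I J) × (J ⊆I I)

  data Gen (S : Carrier → Set) : Carrier → Set where
    base : ∀ {x} → S x → Gen S x
    down : ∀ {x y} → y ≤ x → Gen S x → Gen S y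
    cov  : ∀ c → (∀ i → Gen S (elt c i)) → Gen S (apex c)

  genIdeal : (Carrier → Set) → Ideal
  genIdeal S = record { mem = Gen S ; downClosed = down ; covClosed = cov }

  -- b ∈ B identified with the smallest C-ideal containing b
  ↑ : Carrier → Ideal
  ↑ b = genIdeal (λ x → x ≡ b)

  1I : Ideal
  1I = record { mem = λ _ → ⊤ ; downClosed = λ _ _ → tt ; covClosed = λ _ _ → tt }

  0I : Ideal
  0I = genIdeal (λ _ → ⊥)

  _∧I_ : Ideal → Ideal → Ideal
  I ∧I J = record
    { mem = λ x → mem I x × mem J x
    ; downClosed = λ y≤x p → downClosed I y≤x (proj₁ p) , downClosed J y≤x (proj₂ p)
    ; covClosed = λ c h → covClosed I c (λ i → proj₁ (h i)) , covClosed J c (λ i → proj₂ (h i))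
    }

  _∨I_ : Ideal → Ideal → Ideal
  I ∨I J = genIdeal (λ x → mem I x ⊎ mem J x)

  ⋁I : {A : Set} → (A → Ideal) → Ideal
  ⋁I {A} f = genIdeal (λ x → Σ A λ a → mem (f a) x)

  ⋀I : {A : Set} → (A → Ideal) → Ideal
  ⋀I {A} f = record
    { mem = λ x → (a : A) → mem (f a) x
    ; downClosed = λ y≤x p a → downClosed (f a) y≤x (p a)
    ; covClosed = λ c h a → covClosed (f a) c (λ i → h i a)
    }

record PreDFramePres : Set₁ where
  field
    P    : FramePres
    N    : FramePres
    con₁ : FramePres.Carrier P → FramePres.Carrier N → Set
    tot₁ : FramePres.Carrier P → FramePres.Carrier N → Set

module _ (D : PreDFramePres) where
  open PreDFramePres D

  Pair : Set₁
  Pair = Ideal P × Ideal N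

  _₊ : Pair → Ideal P
  _₊ = proj₁

  _₋ : Pair → Ideal N
  _₋ = proj₂

  _⊑_ : Pair → Pair → Set
  α ⊑ β = _⊆I_ P (α ₊) (β ₊) × _⊆I_ N (α ₋) (β ₋)

  _∨L_ : Pair → Pair → Pair
  α ∨L β = _∨I_ P (α ₊) (β ₊) , _∧I_ N (α ₋) (β ₋)

  _∧L_ : Pair → Pair → Pair
  α ∧L β = _∧I_ P (α ₊) (β ₊) , _∨I_ N (α ₋) (β ₋)

  ttL : Pair
  ttL = 1I P , 0I N

  ffL : Pair
  ffL = 0I P , 1I N

  ι : FramePres.Carrier P → FramePres.Carrier N → Pair
  ι a b = ↑ P a , ↑ N b

  data InCon₁ : Pair → Set₁ where
    emb : ∀ {a b} → con₁ a b → InCon₁ (ι a b)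

  data InTot₁ : Pair → Set₁ where
    emb : ∀ {a b} → tot₁ a b → InTot₁ (ι a b)

  Directed : {A : Set} → (A → Pair) → Set
  Directed {A} f = A × (∀ i j → Σ A λ k → (f i ⊑ f k) × (f j ⊑ f k))

  ⊔Fam : {A : Set} → (A → Pair) → Pair
  ⊔Fam f = ⋁I P (λ i → f i ₊) , ⋁I N (λ i → f i ₋)

  data Con* : Pair → Set₁ where
    base  : ∀ {α} → InCon₁ α → Con* α
    tt∈   : Con* ttL
    ff∈   : Con* ffL
    down  : ∀ {α β} → α ⊑ β → Con* β → Con* α
    meet  : ∀ {α β} → Con* α → Con* β → Con* (α ∧L β)
    join  : ∀ {α β} → Con* α → Con* β → Con* (α ∨L β)
    dirJ  : ∀ {A : Set} (f : A → Pair) → Directed f →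
            (∀ i → Con* (f i)) → Con* (⊔Fam f)

  data Tot* : Pair → Set₁ where
    base  : ∀ {α} → InTot₁ α → Tot* α
    tt∈   : Tot* ttL
    ff∈   : Tot* ffL
    up    : ∀ {α β} → α ⊑ β → Tot* α → Tot* β
    meet  : ∀ {α β} → Tot* α → Tot* β → Tot* (α ∧L β)
    join  : ∀ {α β} → Tot* α → Tot* β → Tot* (α ∨L β)

  data MeetCl (R : Pair → Set₁) : Pair → Set₁ where
    base : ∀ {α} → R α → MeetCl R α
    unit : MeetCl R ttL
    meet : ∀ {α β} → MeetCl R α → MeetCl R β → MeetCl R (α ∧L β)

  data JoinCl (R : Pair → Set₁) : Pair → Set₁ where
    base : ∀ {α} → R α → JoinCl R α
    unit : JoinCl R ffL
    join : ∀ {α β} → JoinCl R α → JoinCl R β → JoinCl R (α ∨L β)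

  con∧ con∨ tot∧ tot∨ : Pair → Set₁
  con∧ = MeetCl InCon₁
  con∨ = JoinCl InCon₁
  tot∧ = MeetCl InTot₁
  tot∨ = JoinCl InTot₁

  con∧⋁ : Pair → Set₁
  con∧⋁ γ = Σ Set λ A → Σ (A → Pair) λ f → ((i : A) → con∧ (f i))
              × (γ ≡ (⋁I P (λ i → f i ₊) , ⋀I N (λ i → f i ₋)))

  con∨⋀ : Pair → Set₁
  con∨⋀ γ = Σ Set λ A → Σ (A → Pair) λ f → ((i : A) → con∨ (f i))
              × (γ ≡ (⋀I P (λ i → f i ₊) , ⋁I N (λ i → f i ₋)))

  ↓ : (Pair → Set₁) → Pair → Set₁
  ↓ R α = Σ Pair λ β → R β × (α ⊑ β)

  μ₊ : Set₁
  μ₊ = ∀ α β → con∨ α → tot∧ β → _⊆I_ P (β ₊) (α ₊) → _⊆I_ N (α ₋) (β ₋)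

  μ₋ : Set₁
  μ₋ = ∀ α β → con∧ α → tot∨ β → _⊆I_ N (β ₋) (α ₋) → _⊆I_ P (α ₊) (β ₊)

  Indep₊ : Set₁
  Indep₊ = ∀ (x : Ideal P) (b : FramePres.Carrier N) →
           ↓ con∧⋁ (x , ↑ N b) → ↓ con∨ (x , ↑ N b)

  Indep₋ : Set₁
  Indep₋ = ∀ (a : FramePres.Carrier P) (y : Ideal N) →
           ↓ con∨⋀ (↑ P a , y) → ↓ con∧ (↑ P a , y)

  ConTot : Set₁
  ConTot = ∀ α β → Con* α → Tot* β →
           (_≈I_ P (α ₊) (β ₊) ⊎ _≈I_ N (α ₋) (β ₋)) → α ⊑ β

-- Every α ∈ Con* lies below (⋁ᵢ αⁱ₊ , ⋀ᵢ αⁱ₋) for a family αⁱ in con∧, by induction on Con*. The only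
-- hard case is a directed join: there one passes, pointwise via Indep₊, to the dual description
-- α ⊑ (⋀ᵢ αⁱ₊ , ⋁ᵢ αⁱ₋) with αⁱ ∈ con∨, which is visibly closed under joins of minus parts, and comes
-- back via Indep₋. Using distributivity of L₊ and L₋, every β ∈ Tot* lies above a finite join
-- of elements of tot∧ and above a finite meet of elements of tot∨, and μ₊, μ₋ extend to these.
-- Now let β₊ ≤ α₊ and b ≤ α₋. Indep₊ puts (α₊ , b) below some γ ∈ con∨; taking a finite join j ⊑ β
-- of elements of tot∧, we have j₊ ≤ β₊ ≤ α₊ ≤ γ₊, so μ₊ gives b ≤ γ₋ ≤ j₋ ≤ β₋. The case β₋ ≤ α₋
-- is dual.

module Submission where

open import Data.Empty using (⊥)
open import Data.Product using (Σ; _×_; _,_; proj₁; proj₂)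
open import Data.Sum using (_⊎_; inj₁; inj₂; [_,_]′)
open import Data.Unit using (⊤; tt)
open import Relation.Binary.PropositionalEquality using (refl; subst; sym)
open import Relation.Binary.Lattice.Structures using (IsBoundedMeetSemilattice)
open import Relation.Unary using (_∩_; _∪_)

open import Defs hiding (_⊆I_; _∧I_; _∨I_; _₊; _₋; _⊑_; _∨L_; _∧L_; ttL; ffL)
import Defs

module _ {F : FramePres} where
  open FramePres F
  open IsBoundedMeetSemilattice isBMS using (x∧y≤x; x∧y≤y; trans) renaming (refl to ≤-refl)

  infix  4 _⊆I_
  infixr 7 _∧I_
  infixr 6 _∨I_

  _⊆I_ : Ideal F → Ideal F → Set
  _⊆I_ = Defs._⊆I_ F

  _∧I_ _∨I_ : Ideal F → Ideal F → Ideal F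
  _∧I_ = Defs._∧I_ F
  _∨I_ = Defs._∨I_ F

  Gen-least : {S : Carrier → Set} (J : Ideal F) → (∀ x → S x → mem J x) → genIdeal F S ⊆I J
  Gen-least J S⊆J x (base s)      = S⊆J x s
  Gen-least J S⊆J _ (down y≤x g)  = downClosed J y≤x (Gen-least J S⊆J _ g)
  Gen-least J S⊆J _ (cov c gs)    = covClosed J c (λ i → Gen-least J S⊆J _ (gs i))

  Gen-mono : {S T : Carrier → Set} → (∀ x → S x → T x) → genIdeal F S ⊆I genIdeal F T
  Gen-mono {T = T} S⊆T = Gen-least (genIdeal F T) (λ x s → base (S⊆T x s))

  ↑-least : {b : Carrier} (J : Ideal F) → mem J b → ↑ F b ⊆I J
  ↑-least J b∈J = Gen-least J (λ { _ refl → b∈J })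

  b∈↑b : ∀ b → mem (↑ F b) b
  b∈↑b b = base refl

  0I-least : (J : Ideal F) → 0I F ⊆I J
  0I-least J = Gen-least J (λ _ ())

  -- The stability axiom of the covers is used only here.
  covClosed-restrict : (J : Ideal F) (c : Cov) {z : Carrier} →
                       z ≤ apex c → (∀ i → mem J (elt c i ∧ z)) → mem J z
  covClosed-restrict J c z≤a restricted∈J with stable c _ z≤a
  ... | c′ , refl , covered , _ = covClosed J c′ λ j →
          let i , eq = covered j in subst (mem J) (sym eq) (restricted∈J i)

  DownClosed : (Carrier → Set) → Set
  DownClosed S = ∀ {x y} → y ≤ x → S x → S y

  mem-∪-downClosed : (I J : Ideal F) → DownClosed (mem I ∪ mem J)
  mem-∪-downClosed I J y≤x (inj₁ x∈I) = inj₁ (downClosed I y≤x x∈I)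
  mem-∪-downClosed I J y≤x (inj₂ x∈J) = inj₂ (downClosed J y≤x x∈J)

  mem-Σ-downClosed : {A : Set} (f : A → Ideal F) → DownClosed (λ x → Σ A λ a → mem (f a) x)
  mem-Σ-downClosed f y≤x (a , x∈) = a , downClosed (f a) y≤x x∈

  module _ {S T : Carrier → Set} (S↓ : DownClosed S) (T↓ : DownClosed T) where

    Gen-∩-below-∈ : ∀ {x y z} → S x → Gen F T y → z ≤ x → z ≤ y → Gen F (S ∩ T) z
    Gen-∩-below-∈ s (base t)      z≤x z≤y = base (S↓ z≤x s , T↓ z≤y t)
    Gen-∩-below-∈ s (down y≤y′ g) z≤x z≤y = Gen-∩-below-∈ s g z≤x (trans z≤y y≤y′)
    Gen-∩-below-∈ s (cov c gs)    z≤x z≤a = covClosed-restrict (genIdeal F (S ∩ T)) c z≤a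
      (λ i → Gen-∩-below-∈ s (gs i) (trans (x∧y≤y _ _) z≤x) (x∧y≤x _ _))

    Gen-∩-below : ∀ {x y z} → Gen F S x → Gen F T y → z ≤ x → z ≤ y → Gen F (S ∩ T) z
    Gen-∩-below (base s)      g z≤x z≤y = Gen-∩-below-∈ s g z≤x z≤y
    Gen-∩-below (down x≤x′ g) h z≤x z≤y = Gen-∩-below g h (trans z≤x x≤x′) z≤y
    Gen-∩-below (cov c gs)    h z≤a z≤y = covClosed-restrict (genIdeal F (S ∩ T)) c z≤a
      (λ i → Gen-∩-below (gs i) h (x∧y≤x _ _) (trans (x∧y≤y _ _) z≤y))

    Gen-∩ : genIdeal F S ∧I genIdeal F T ⊆I genIdeal F (S ∩ T)
    Gen-∩ x (gS , gT) = Gen-∩-below gS gT ≤-refl ≤-refl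

  ∧I-distribˡ-∨I-⊇ : (I J K : Ideal F) → (I ∧I J) ∨I (I ∧I K) ⊆I I ∧I (J ∨I K)
  ∧I-distribˡ-∨I-⊇ I J K = Gen-least (I ∧I (J ∨I K)) λ
    { x (inj₁ (x∈I , x∈J)) → x∈I , base (inj₁ x∈J)
    ; x (inj₂ (x∈I , x∈K)) → x∈I , base (inj₂ x∈K) }

  ∧I-distribʳ-∨I-⊇ : (I J K : Ideal F) → (J ∧I I) ∨I (K ∧I I) ⊆I (J ∨I K) ∧I I
  ∧I-distribʳ-∨I-⊇ I J K = Gen-least ((J ∨I K) ∧I I) λ
    { x (inj₁ (x∈J , x∈I)) → base (inj₁ x∈J) , x∈I
    ; x (inj₂ (x∈K , x∈I)) → base (inj₂ x∈K) , x∈I }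

  ∨I-distribˡ-∧I-⊇ : (I J K : Ideal F) → (I ∨I J) ∧I (I ∨I K) ⊆I I ∨I (J ∧I K)
  ∨I-distribˡ-∧I-⊇ I J K x x∈ =
    Gen-mono (λ { _ (inj₁ z∈I , _)        → inj₁ z∈I
                ; _ (inj₂ _ , inj₁ z∈I)   → inj₁ z∈I
                ; _ (inj₂ z∈J , inj₂ z∈K) → inj₂ (z∈J , z∈K) })
             x (Gen-∩ (mem-∪-downClosed I J) (mem-∪-downClosed I K) x x∈)

  ∨I-distribʳ-∧I-⊇ : (I J K : Ideal F) → (J ∨I I) ∧I (K ∨I I) ⊆I (J ∧I K) ∨I I
  ∨I-distribʳ-∧I-⊇ I J K x x∈ =
    Gen-mono (λ { _ (inj₂ z∈I , _)        → inj₂ z∈I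
                ; _ (inj₁ _ , inj₂ z∈I)   → inj₂ z∈I
                ; _ (inj₁ z∈J , inj₁ z∈K) → inj₁ (z∈J , z∈K) })
             x (Gen-∩ (mem-∪-downClosed J I) (mem-∪-downClosed K I) x x∈)

  ⋁I-∧I-⊆ : {A B : Set} (f : A → Ideal F) (g : B → Ideal F) →
            ⋁I F f ∧I ⋁I F g ⊆I ⋁I F (λ ab → f (proj₁ ab) ∧I g (proj₂ ab))
  ⋁I-∧I-⊆ f g x x∈ =
    Gen-mono (λ { _ ((a , z∈fa) , (b , z∈gb)) → (a , b) , z∈fa , z∈gb })
             x (Gen-∩ (mem-Σ-downClosed f) (mem-Σ-downClosed g) x x∈)

  ⋀I-∨I-⊆ : {A B : Set} (f : A → Ideal F) (g : B → Ideal F) →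
            ⋀I F f ∨I ⋀I F g ⊆I ⋀I F (λ ab → f (proj₁ ab) ∨I g (proj₂ ab))
  ⋀I-∨I-⊆ f g = Gen-least (⋀I F (λ ab → f (proj₁ ab) ∨I g (proj₂ ab))) λ
    { x (inj₁ x∈⋀f) (a , _) → base (inj₁ (x∈⋀f a))
    ; x (inj₂ x∈⋀g) (_ , b) → base (inj₂ (x∈⋀g b)) }

  ⋁I-⊎-⊆ : {A B : Set} (h : A ⊎ B → Ideal F) →
           ⋁I F (λ a → h (inj₁ a)) ∨I ⋁I F (λ b → h (inj₂ b)) ⊆I ⋁I F h
  ⋁I-⊎-⊆ h = Gen-least (⋁I F h) λ
    { x (inj₁ x∈) → Gen-mono (λ { y (a , y∈) → inj₁ a , y∈ }) x x∈
    ; x (inj₂ x∈) → Gen-mono (λ { y (b , y∈) → inj₂ b , y∈ }) x x∈ }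

module PairLattice (D : PreDFramePres) where
  open PreDFramePres D

  infix  4 _⊑_
  infixr 7 _∧L_
  infixr 6 _∨L_

  _₊ : Pair D → Ideal P
  _₊ = Defs._₊ D

  _₋ : Pair D → Ideal N
  _₋ = Defs._₋ D

  _⊑_ : Pair D → Pair D → Set
  _⊑_ = Defs._⊑_ D

  _∧L_ _∨L_ : Pair D → Pair D → Pair D
  _∧L_ = Defs._∧L_ D
  _∨L_ = Defs._∨L_ D

  ttL ffL : Pair D
  ttL = Defs.ttL D
  ffL = Defs.ffL D

  -- Pairs and ideals cannot be inferred through ⊑ and ⊆I, which unfold to membership predicates;
  -- hence the explicitly supplied implicit arguments throughout.
  ⊑-refl : (α : Pair D) → α ⊑ α
  ⊑-refl α = (λ _ x∈ → x∈) , (λ _ x∈ → x∈)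

  ⊑-trans : {α β γ : Pair D} → α ⊑ β → β ⊑ γ → α ⊑ γ
  ⊑-trans (⊆₊ , ⊆₋) (⊆₊′ , ⊆₋′) = (λ x x∈ → ⊆₊′ x (⊆₊ x x∈)) , (λ x x∈ → ⊆₋′ x (⊆₋ x x∈))

  ∧L-mono : {α α′ β β′ : Pair D} → α ⊑ α′ → β ⊑ β′ → α ∧L β ⊑ α′ ∧L β′
  ∧L-mono (⊆₊ , ⊆₋) (⊆₊′ , ⊆₋′) =
    (λ x (x∈ , x∈′) → ⊆₊ x x∈ , ⊆₊′ x x∈′) ,
    Gen-mono (λ { x (inj₁ x∈) → inj₁ (⊆₋ x x∈) ; x (inj₂ x∈) → inj₂ (⊆₋′ x x∈) })

  ∨L-mono : {α α′ β β′ : Pair D} → α ⊑ α′ → β ⊑ β′ → α ∨L β ⊑ α′ ∨L β′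
  ∨L-mono (⊆₊ , ⊆₋) (⊆₊′ , ⊆₋′) =
    Gen-mono (λ { x (inj₁ x∈) → inj₁ (⊆₊ x x∈) ; x (inj₂ x∈) → inj₂ (⊆₊′ x x∈) }) ,
    (λ x (x∈ , x∈′) → ⊆₋ x x∈ , ⊆₋′ x x∈′)

  ∧L-zeroˡ-⊒ : (α : Pair D) → ffL ⊑ ffL ∧L α
  ∧L-zeroˡ-⊒ α = 0I-least (0I P ∧I α ₊) , (λ _ x∈ → base (inj₁ x∈))

  ∧L-zeroʳ-⊒ : (α : Pair D) → ffL ⊑ α ∧L ffL
  ∧L-zeroʳ-⊒ α = 0I-least (α ₊ ∧I 0I P) , (λ _ x∈ → base (inj₂ x∈))

  ∨L-zeroˡ-⊒ : (α : Pair D) → ttL ⊑ ttL ∨L α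
  ∨L-zeroˡ-⊒ α = (λ _ x∈ → base (inj₁ x∈)) , 0I-least (0I N ∧I α ₋)

  ∨L-zeroʳ-⊒ : (α : Pair D) → ttL ⊑ α ∨L ttL
  ∨L-zeroʳ-⊒ α = (λ _ x∈ → base (inj₂ x∈)) , 0I-least (α ₋ ∧I 0I N)

  ∧L-distribˡ-∨L-⊒ : (α β γ : Pair D) → (α ∧L β) ∨L (α ∧L γ) ⊑ α ∧L (β ∨L γ)
  ∧L-distribˡ-∨L-⊒ (a , a′) (b , b′) (c , c′) = ∧I-distribˡ-∨I-⊇ a b c , ∨I-distribˡ-∧I-⊇ a′ b′ c′

  ∧L-distribʳ-∨L-⊒ : (α β γ : Pair D) → (β ∧L α) ∨L (γ ∧L α) ⊑ (β ∨L γ) ∧L α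
  ∧L-distribʳ-∨L-⊒ (a , a′) (b , b′) (c , c′) = ∧I-distribʳ-∨I-⊇ a b c , ∨I-distribʳ-∧I-⊇ a′ b′ c′

  ∨L-distribˡ-∧L-⊒ : (α β γ : Pair D) → (α ∨L β) ∧L (α ∨L γ) ⊑ α ∨L (β ∧L γ)
  ∨L-distribˡ-∧L-⊒ (a , a′) (b , b′) (c , c′) = ∨I-distribˡ-∧I-⊇ a b c , ∧I-distribˡ-∨I-⊇ a′ b′ c′

  ∨L-distribʳ-∧L-⊒ : (α β γ : Pair D) → (β ∨L α) ∧L (γ ∨L α) ⊑ (β ∧L γ) ∨L α
  ∨L-distribʳ-∧L-⊒ (a , a′) (b , b′) (c , c′) = ∨I-distribʳ-∧I-⊇ a b c , ∧I-distribʳ-∨I-⊇ a′ b′ c′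

module TotNormalForms (D : PreDFramePres) where
  open PairLattice D

  record Above (R : Pair D → Set₁) (β : Pair D) : Set₁ where
    constructor above
    field
      {lower}  : Pair D
      lower∈   : R lower
      lower⊑   : lower ⊑ β

  Above-weaken : {R : Pair D → Set₁} {β β′ : Pair D} → β ⊑ β′ → Above R β → Above R β′
  Above-weaken {β = β} {β′} β⊑β′ (above {α} α∈ α⊑β) = above α∈ (⊑-trans {α} {β} {β′} α⊑β β⊑β′)

  module _ {R : Pair D → Set₁} where

    Above-JoinCl-∨L : {β γ : Pair D} → Above (JoinCl D R) β → Above (JoinCl D R) γ →
                      Above (JoinCl D R) (β ∨L γ)
    Above-JoinCl-∨L {β} {γ} (above {α} α∈ α⊑β) (above {α′} α′∈ α′⊑γ) =
      above (join α∈ α′∈) (∨L-mono {α} {β} {α′} {γ} α⊑β α′⊑γ)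

    Above-MeetCl-∧L : {β γ : Pair D} → Above (MeetCl D R) β → Above (MeetCl D R) γ →
                      Above (MeetCl D R) (β ∧L γ)
    Above-MeetCl-∧L {β} {γ} (above {α} α∈ α⊑β) (above {α′} α′∈ α′⊑γ) =
      above (meet α∈ α′∈) (∧L-mono {α} {β} {α′} {γ} α⊑β α′⊑γ)

    JoinCl-∧L : (∀ {α β} → R α → R β → R (α ∧L β)) →
                ∀ {α β} → JoinCl D R α → JoinCl D R β → Above (JoinCl D R) (α ∧L β)
    JoinCl-∧L R-∧ {α} {β} (base r) (base r′) = above (base (R-∧ {α} {β} r r′)) (⊑-refl (α ∧L β))
    JoinCl-∧L R-∧ {α} (base _) unit = above unit (∧L-zeroʳ-⊒ α)
    JoinCl-∧L R-∧ {α} r@(base _) (join {β} {γ} p q) =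
      Above-weaken {β = (α ∧L β) ∨L (α ∧L γ)} (∧L-distribˡ-∨L-⊒ α β γ)
        (Above-JoinCl-∨L (JoinCl-∧L R-∧ r p) (JoinCl-∧L R-∧ r q))
    JoinCl-∧L R-∧ {β = β} unit _ = above unit (∧L-zeroˡ-⊒ β)
    JoinCl-∧L R-∧ {β = β} (join {α} {α′} p p′) q =
      Above-weaken {β = (α ∧L β) ∨L (α′ ∧L β)} (∧L-distribʳ-∨L-⊒ β α α′)
        (Above-JoinCl-∨L (JoinCl-∧L R-∧ p q) (JoinCl-∧L R-∧ p′ q))

    MeetCl-∨L : (∀ {α β} → R α → R β → R (α ∨L β)) →
                ∀ {α β} → MeetCl D R α → MeetCl D R β → Above (MeetCl D R) (α ∨L β)
    MeetCl-∨L R-∨ {α} {β} (base r) (base r′) = above (base (R-∨ {α} {β} r r′)) (⊑-refl (α ∨L β))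
    MeetCl-∨L R-∨ {α} (base _) unit = above unit (∨L-zeroʳ-⊒ α)
    MeetCl-∨L R-∨ {α} r@(base _) (meet {β} {γ} p q) =
      Above-weaken {β = (α ∨L β) ∧L (α ∨L γ)} (∨L-distribˡ-∧L-⊒ α β γ)
        (Above-MeetCl-∧L (MeetCl-∨L R-∨ r p) (MeetCl-∨L R-∨ r q))
    MeetCl-∨L R-∨ {β = β} unit _ = above unit (∨L-zeroˡ-⊒ β)
    MeetCl-∨L R-∨ {β = β} (meet {α} {α′} p p′) q =
      Above-weaken {β = (α ∨L β) ∧L (α′ ∨L β)} (∨L-distribʳ-∧L-⊒ β α α′)
        (Above-MeetCl-∧L (MeetCl-∨L R-∨ p q) (MeetCl-∨L R-∨ p′ q))

    Above-JoinCl-∧L : (∀ {α β} → R α → R β → R (α ∧L β)) → {β γ : Pair D} →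
                      Above (JoinCl D R) β → Above (JoinCl D R) γ → Above (JoinCl D R) (β ∧L γ)
    Above-JoinCl-∧L R-∧ {β} {γ} (above {α} α∈ α⊑β) (above {α′} α′∈ α′⊑γ) =
      Above-weaken {β = α ∧L α′} (∧L-mono {α} {β} {α′} {γ} α⊑β α′⊑γ) (JoinCl-∧L R-∧ α∈ α′∈)

    Above-MeetCl-∨L : (∀ {α β} → R α → R β → R (α ∨L β)) → {β γ : Pair D} →
                      Above (MeetCl D R) β → Above (MeetCl D R) γ → Above (MeetCl D R) (β ∨L γ)
    Above-MeetCl-∨L R-∨ {β} {γ} (above {α} α∈ α⊑β) (above {α′} α′∈ α′⊑γ) =
      Above-weaken {β = α ∨L α′} (∨L-mono {α} {β} {α′} {γ} α⊑β α′⊑γ) (MeetCl-∨L R-∨ α∈ α′∈)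

  tot∧∨ tot∨∧ : Pair D → Set₁
  tot∧∨ = JoinCl D (tot∧ D)
  tot∨∧ = MeetCl D (tot∨ D)

  Tot*⇒Above-tot∧∨ : {β : Pair D} → Tot* D β → Above tot∧∨ β
  Tot*⇒Above-tot∧∨ (base {α} t)        = above (base (base t)) (⊑-refl α)
  Tot*⇒Above-tot∧∨ tt∈                 = above (base unit) (⊑-refl ttL)
  Tot*⇒Above-tot∧∨ ff∈                 = above unit (⊑-refl ffL)
  Tot*⇒Above-tot∧∨ (up {β} {β′} β⊑β′ t) = Above-weaken {β = β} {β′} β⊑β′ (Tot*⇒Above-tot∧∨ t)
  Tot*⇒Above-tot∧∨ (meet t t′)         = Above-JoinCl-∧L meet (Tot*⇒Above-tot∧∨ t) (Tot*⇒Above-tot∧∨ t′)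
  Tot*⇒Above-tot∧∨ (join t t′)         = Above-JoinCl-∨L (Tot*⇒Above-tot∧∨ t) (Tot*⇒Above-tot∧∨ t′)

  Tot*⇒Above-tot∨∧ : {β : Pair D} → Tot* D β → Above tot∨∧ β
  Tot*⇒Above-tot∨∧ (base {α} t)        = above (base (base t)) (⊑-refl α)
  Tot*⇒Above-tot∨∧ tt∈                 = above unit (⊑-refl ttL)
  Tot*⇒Above-tot∨∧ ff∈                 = above (base unit) (⊑-refl ffL)
  Tot*⇒Above-tot∨∧ (up {β} {β′} β⊑β′ t) = Above-weaken {β = β} {β′} β⊑β′ (Tot*⇒Above-tot∨∧ t)
  Tot*⇒Above-tot∨∧ (meet t t′)         = Above-MeetCl-∧L (Tot*⇒Above-tot∨∧ t) (Tot*⇒Above-tot∨∧ t′)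
  Tot*⇒Above-tot∨∧ (join t t′)         = Above-MeetCl-∨L join (Tot*⇒Above-tot∨∧ t) (Tot*⇒Above-tot∨∧ t′)

  μ₊-tot∧∨ : μ₊ D → ∀ γ β → con∨ D γ → tot∧∨ β → β ₊ ⊆I γ ₊ → γ ₋ ⊆I β ₋
  μ₊-tot∧∨ μ γ β γ∈ (base β∈) β⊆γ = μ γ β γ∈ β∈ β⊆γ
  μ₊-tot∧∨ μ γ _ γ∈ unit _ _ _ = tt
  μ₊-tot∧∨ μ γ _ γ∈ (join {β} {β′} p q) β⊆γ x x∈ =
    μ₊-tot∧∨ μ γ β γ∈ p (λ y y∈ → β⊆γ y (base (inj₁ y∈))) x x∈ ,
    μ₊-tot∧∨ μ γ β′ γ∈ q (λ y y∈ → β⊆γ y (base (inj₂ y∈))) x x∈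

  μ₋-tot∨∧ : μ₋ D → ∀ γ β → con∧ D γ → tot∨∧ β → β ₋ ⊆I γ ₋ → γ ₊ ⊆I β ₊
  μ₋-tot∨∧ μ γ β γ∈ (base β∈) β⊆γ = μ γ β γ∈ β∈ β⊆γ
  μ₋-tot∨∧ μ γ _ γ∈ unit _ _ _ = tt
  μ₋-tot∨∧ μ γ _ γ∈ (meet {β} {β′} p q) β⊆γ x x∈ =
    μ₋-tot∨∧ μ γ β γ∈ p (λ y y∈ → β⊆γ y (base (inj₁ y∈))) x x∈ ,
    μ₋-tot∨∧ μ γ β′ γ∈ q (λ y y∈ → β⊆γ y (base (inj₂ y∈))) x x∈

module ConNormalForm (D : PreDFramePres) where
  open PreDFramePres D
  open PairLattice D

  ⋁₊⋀₋ ⋀₊⋁₋ : {A : Set} → (A → Pair D) → Pair D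
  ⋁₊⋀₋ f = ⋁I P (λ i → f i ₊) , ⋀I N (λ i → f i ₋)
  ⋀₊⋁₋ f = ⋀I P (λ i → f i ₊) , ⋁I N (λ i → f i ₋)

  record Below (R : Pair D → Set₁) (⨆ : {A : Set} → (A → Pair D) → Pair D) (α : Pair D) : Set₁ where
    constructor below
    field
      {Idx}  : Set
      fam    : Idx → Pair D
      fam∈   : ∀ i → R (fam i)
      ⊑⨆fam  : α ⊑ ⨆ fam
  open Below

  -- ↓ D (con∧⋁ D) and ↓ D (con∨⋀ D), with the family kept as data instead of an equation of pairs.
  ⇓con∧⋁ ⇓con∨⋀ : Pair D → Set₁
  ⇓con∧⋁ = Below (con∧ D) ⋁₊⋀₋
  ⇓con∨⋀ = Below (con∨ D) ⋀₊⋁₋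

  Below-down : {R : Pair D → Set₁} {⨆ : {A : Set} → (A → Pair D) → Pair D} {α β : Pair D} →
               α ⊑ β → Below R ⨆ β → Below R ⨆ α
  Below-down {⨆ = ⨆} {α} {β} α⊑β (below f f∈ β⊑) = below f f∈ (⊑-trans {α} {β} {⨆ f} α⊑β β⊑)

  ⇓con∧⋁⇒↓con∧⋁ : {α : Pair D} → ⇓con∧⋁ α → ↓ D (con∧⋁ D) α
  ⇓con∧⋁⇒↓con∧⋁ (below f f∈ α⊑) = ⋁₊⋀₋ f , (_ , f , f∈ , refl) , α⊑

  ⇓con∨⋀⇒↓con∨⋀ : {α : Pair D} → ⇓con∨⋀ α → ↓ D (con∨⋀ D) α
  ⇓con∨⋀⇒↓con∨⋀ (below f f∈ α⊑) = ⋀₊⋁₋ f , (_ , f , f∈ , refl) , α⊑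

  con∧⇒⇓con∧⋁ : {α : Pair D} → con∧ D α → ⇓con∧⋁ α
  con∧⇒⇓con∧⋁ {α} α∈ = below {Idx = ⊤} (λ _ → α) (λ _ → α∈) ((λ x x∈ → base (tt , x∈)) , (λ _ x∈ _ → x∈))

  ⇓con∧⋁-ff : ⇓con∧⋁ ffL
  ⇓con∧⋁-ff = below {Idx = ⊥} (λ ()) (λ ()) (Gen-mono (λ _ ()) , (λ _ _ ()))

  ⋁₊⋀₋-∧L : {A B : Set} (f : A → Pair D) (g : B → Pair D) →
            ⋁₊⋀₋ f ∧L ⋁₊⋀₋ g ⊑ ⋁₊⋀₋ (λ ab → f (proj₁ ab) ∧L g (proj₂ ab))
  ⋁₊⋀₋-∧L f g = ⋁I-∧I-⊆ (λ a → f a ₊) (λ b → g b ₊) , ⋀I-∨I-⊆ (λ a → f a ₋) (λ b → g b ₋)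

  ⋁₊⋀₋-∨L : {A B : Set} (f : A → Pair D) (g : B → Pair D) →
            ⋁₊⋀₋ f ∨L ⋁₊⋀₋ g ⊑ ⋁₊⋀₋ [ f , g ]′
  ⋁₊⋀₋-∨L f g = ⋁I-⊎-⊆ (λ ab → [ f , g ]′ ab ₊) ,
                λ { _ (x∈f , _) (inj₁ a) → x∈f a ; _ (_ , x∈g) (inj₂ b) → x∈g b }

  ⇓con∧⋁-∧L : {α β : Pair D} → ⇓con∧⋁ α → ⇓con∧⋁ β → ⇓con∧⋁ (α ∧L β)
  ⇓con∧⋁-∧L {α} {β} (below f f∈ α⊑) (below g g∈ β⊑) =
    below (λ ab → f (proj₁ ab) ∧L g (proj₂ ab)) (λ ab → meet (f∈ (proj₁ ab)) (g∈ (proj₂ ab)))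
      (⊑-trans {α ∧L β} {⋁₊⋀₋ f ∧L ⋁₊⋀₋ g} {⋁₊⋀₋ (λ ab → f (proj₁ ab) ∧L g (proj₂ ab))}
        (∧L-mono {α} {⋁₊⋀₋ f} {β} {⋁₊⋀₋ g} α⊑ β⊑) (⋁₊⋀₋-∧L f g))

  ⇓con∧⋁-∨L : {α β : Pair D} → ⇓con∧⋁ α → ⇓con∧⋁ β → ⇓con∧⋁ (α ∨L β)
  ⇓con∧⋁-∨L {α} {β} (below f f∈ α⊑) (below g g∈ β⊑) =
    below [ f , g ]′ (λ { (inj₁ a) → f∈ a ; (inj₂ b) → g∈ b })
      (⊑-trans {α ∨L β} {⋁₊⋀₋ f ∨L ⋁₊⋀₋ g} {⋁₊⋀₋ [ f , g ]′}
        (∨L-mono {α} {⋁₊⋀₋ f} {β} {⋁₊⋀₋ g} α⊑ β⊑) (⋁₊⋀₋-∨L f g))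

  ⇓con∧⋁-⋁₊-directed : {A : Set} {f : A → Pair D} → Directed D f → (∀ k → ⇓con∧⋁ (f k)) →
                  ∀ k → ⇓con∧⋁ (⋁I P (λ j → f j ₊) , f k ₋)
  ⇓con∧⋁-⋁₊-directed {A} {f} (_ , directed) f↓ k = below g (λ (m , i) → fam∈ (f↓ (proj₁ m)) i) (⊆₊ , ⊆₋)
    where
    Index : Set
    Index = Σ (Σ A λ m → f k ⊑ f m) λ m → Idx (f↓ (proj₁ m))

    g : Index → Pair D
    g (m , i) = fam (f↓ (proj₁ m)) i

    ⊆₊ : ⋁I P (λ j → f j ₊) ⊆I ⋁I P (λ mi → g mi ₊)
    ⊆₊ = Gen-least (⋁I P (λ mi → g mi ₊)) λ x (j , x∈fj) →
      let m , k⊑m , j⊑m = directed k j in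
      Gen-mono (λ { _ (i , y∈) → ((m , k⊑m) , i) , y∈ }) x (proj₁ (⊑⨆fam (f↓ m)) x (proj₁ j⊑m x x∈fj))

    ⊆₋ : f k ₋ ⊆I ⋀I N (λ mi → g mi ₋)
    ⊆₋ x x∈ ((m , k⊑m) , i) = proj₂ (⊑⨆fam (f↓ m)) x (proj₂ k⊑m x x∈) i

  ⇓con∨⋀-⋁₋ : {A : Set} {x : Ideal P} {y : A → Ideal N} →
              (∀ k → ⇓con∨⋀ (x , y k)) → ⇓con∨⋀ (x , ⋁I N y)
  ⇓con∨⋀-⋁₋ {A} {x} {y} y↓ = below g (λ (k , i) → fam∈ (y↓ k) i) (⊆₊ , ⊆₋)
    where
    g : (Σ A λ k → Idx (y↓ k)) → Pair D
    g (k , i) = fam (y↓ k) i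

    ⊆₊ : x ⊆I ⋀I P (λ ki → g ki ₊)
    ⊆₊ z z∈ (k , i) = proj₁ (⊑⨆fam (y↓ k)) z z∈ i

    ⊆₋ : ⋁I N y ⊆I ⋁I N (λ ki → g ki ₋)
    ⊆₋ = Gen-least (⋁I N (λ ki → g ki ₋)) λ z (k , z∈) →
      Gen-mono (λ { _ (i , w∈) → (k , i) , w∈ }) z (proj₂ (⊑⨆fam (y↓ k)) z z∈)

  ⇓con∧⋁⇒↓con∨ : Indep₊ D → {α : Pair D} {b : FramePres.Carrier N} →
                 ⇓con∧⋁ α → mem (α ₋) b → ↓ D (con∨ D) (α ₊ , ↑ N b)
  ⇓con∧⋁⇒↓con∨ indep {α} {b} α↓ b∈ =
    indep (α ₊) b (⇓con∧⋁⇒↓con∧⋁ (Below-down {α = α ₊ , ↑ N b} {α} ((λ _ x∈ → x∈) , ↑-least (α ₋) b∈) α↓))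

  ⇓con∨⋀⇒↓con∧ : Indep₋ D → {α : Pair D} {a : FramePres.Carrier P} →
                 ⇓con∨⋀ α → mem (α ₊) a → ↓ D (con∧ D) (↑ P a , α ₋)
  ⇓con∨⋀⇒↓con∧ indep {α} {a} α↓ a∈ =
    indep a (α ₋) (⇓con∨⋀⇒↓con∨⋀ (Below-down {α = ↑ P a , α ₋} {α} (↑-least (α ₊) a∈ , (λ _ x∈ → x∈)) α↓))

  ⇓con∧⋁⇒⇓con∨⋀ : Indep₊ D → {α : Pair D} → ⇓con∧⋁ α → ⇓con∨⋀ α
  ⇓con∧⋁⇒⇓con∨⋀ indep {α} α↓ = below (λ b → proj₁ (point b)) (λ b → proj₁ (proj₂ (point b))) (⊆₊ , ⊆₋)
    where
    point : (b : Σ (FramePres.Carrier N) (mem (α ₋))) → ↓ D (con∨ D) (α ₊ , ↑ N (proj₁ b))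
    point (b , b∈) = ⇓con∧⋁⇒↓con∨ indep α↓ b∈

    ⊆₊ : α ₊ ⊆I ⋀I P (λ b → proj₁ (point b) ₊)
    ⊆₊ x x∈ b = let _ , _ , α₊⊆γ₊ , _ = point b in α₊⊆γ₊ x x∈

    ⊆₋ : α ₋ ⊆I ⋁I N (λ b → proj₁ (point b) ₋)
    ⊆₋ b b∈ = let _ , _ , _ , ↑b⊆γ₋ = point (b , b∈) in base ((b , b∈) , ↑b⊆γ₋ b (b∈↑b b))

  ⇓con∨⋀⇒⇓con∧⋁ : Indep₋ D → {α : Pair D} → ⇓con∨⋀ α → ⇓con∧⋁ α
  ⇓con∨⋀⇒⇓con∧⋁ indep {α} α↓ = below (λ a → proj₁ (point a)) (λ a → proj₁ (proj₂ (point a))) (⊆₊ , ⊆₋)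
    where
    point : (a : Σ (FramePres.Carrier P) (mem (α ₊))) → ↓ D (con∧ D) (↑ P (proj₁ a) , α ₋)
    point (a , a∈) = ⇓con∨⋀⇒↓con∧ indep α↓ a∈

    ⊆₊ : α ₊ ⊆I ⋁I P (λ a → proj₁ (point a) ₊)
    ⊆₊ a a∈ = let _ , _ , ↑a⊆γ₊ , _ = point (a , a∈) in base ((a , a∈) , ↑a⊆γ₊ a (b∈↑b a))

    ⊆₋ : α ₋ ⊆I ⋀I N (λ a → proj₁ (point a) ₋)
    ⊆₋ x x∈ a = let _ , _ , _ , α₋⊆γ₋ = point a in α₋⊆γ₋ x x∈

  module _ (indep₊ : Indep₊ D) (indep₋ : Indep₋ D) where

    Con*⇒⇓con∧⋁ : {α : Pair D} → Con* D α → ⇓con∧⋁ α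
    Con*⇒⇓con∧⋁ (base (emb c))       = con∧⇒⇓con∧⋁ (base (emb c))
    Con*⇒⇓con∧⋁ tt∈                  = con∧⇒⇓con∧⋁ unit
    Con*⇒⇓con∧⋁ ff∈                  = ⇓con∧⋁-ff
    Con*⇒⇓con∧⋁ (down {α} {β} α⊑β c) = Below-down {α = α} {β} α⊑β (Con*⇒⇓con∧⋁ c)
    Con*⇒⇓con∧⋁ (meet c c′)          = ⇓con∧⋁-∧L (Con*⇒⇓con∧⋁ c) (Con*⇒⇓con∧⋁ c′)
    Con*⇒⇓con∧⋁ (join c c′)          = ⇓con∧⋁-∨L (Con*⇒⇓con∧⋁ c) (Con*⇒⇓con∧⋁ c′)
    Con*⇒⇓con∧⋁ (dirJ f directed c)  = ⇓con∨⋀⇒⇓con∧⋁ indep₋ (⇓con∨⋀-⋁₋ λ k →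
      ⇓con∧⋁⇒⇓con∨⋀ indep₊ (⇓con∧⋁-⋁₊-directed directed (λ j → Con*⇒⇓con∧⋁ (c j)) k))

module ConTotFromNormalForms (D : PreDFramePres) where
  open PairLattice D
  open TotNormalForms D
  open ConNormalForm D

  μ₊-Con*-Tot* : μ₊ D → Indep₊ D → Indep₋ D →
                 ∀ α β → Con* D α → Tot* D β → β ₊ ⊆I α ₊ → α ₋ ⊆I β ₋
  μ₊-Con*-Tot* μ indep₊ indep₋ α β α∈ β∈ β₊⊆α₊ x x∈
    with ⇓con∧⋁⇒↓con∨ indep₊ (Con*⇒⇓con∧⋁ indep₊ indep₋ α∈) x∈ | Tot*⇒Above-tot∧∨ β∈
  ... | γ , γ∈ , α₊⊆γ₊ , ↑x⊆γ₋ | above {j} j∈ (j₊⊆β₊ , j₋⊆β₋) =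
    j₋⊆β₋ x (μ₊-tot∧∨ μ γ j γ∈ j∈ (λ y y∈ → α₊⊆γ₊ y (β₊⊆α₊ y (j₊⊆β₊ y y∈))) x (↑x⊆γ₋ x (b∈↑b x)))

  μ₋-Con*-Tot* : μ₋ D → Indep₊ D → Indep₋ D →
                 ∀ α β → Con* D α → Tot* D β → β ₋ ⊆I α ₋ → α ₊ ⊆I β ₊
  μ₋-Con*-Tot* μ indep₊ indep₋ α β α∈ β∈ β₋⊆α₋ x x∈
    with ⇓con∨⋀⇒↓con∧ indep₋ (⇓con∧⋁⇒⇓con∨⋀ indep₊ (Con*⇒⇓con∧⋁ indep₊ indep₋ α∈)) x∈
       | Tot*⇒Above-tot∨∧ β∈
  ... | γ , γ∈ , ↑x⊆γ₊ , α₋⊆γ₋ | above {j} j∈ (j₊⊆β₊ , j₋⊆β₋) =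
    j₊⊆β₊ x (μ₋-tot∨∧ μ γ j γ∈ j∈ (λ y y∈ → α₋⊆γ₋ y (β₋⊆α₋ y (j₋⊆β₋ y y∈))) x (↑x⊆γ₊ x (b∈↑b x)))

open ConTotFromNormalForms using (μ₊-Con*-Tot*; μ₋-Con*-Tot*)

proposition17 : (D : PreDFramePres) → μ₊ D → μ₋ D → Indep₊ D → Indep₋ D → ConTot D
proposition17 D μ⁺ μ⁻ indep₊ indep₋ α β α∈ β∈ (inj₁ (α₊⊆β₊ , β₊⊆α₊)) =
  α₊⊆β₊ , μ₊-Con*-Tot* D μ⁺ indep₊ indep₋ α β α∈ β∈ β₊⊆α₊
proposition17 D μ⁺ μ⁻ indep₊ indep₋ α β α∈ β∈ (inj₂ (α₋⊆β₋ , β₋⊆α₋)) =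
  μ₋-Con*-Tot* D μ⁻ indep₊ indep₋ α β α∈ β∈ β₋⊆α₋ , α₋⊆β₋
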